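{- Let $\Pi$ be an infinitary program and $\mathcal I$ an interpretation. If $\Pi$ is tight on $\mathcal I$ and $\mathcal I$ satisfies the completion of $\Pi$, then $\mathcal I$ is a stable model of $\Pi$.
   Context: Fix a set $\sigma$ of atoms (the signature). Infinitary formulas over $\sigma$: atoms of $\sigma$, $\bot$, $\mathcal H^\wedge$ and $\mathcal H^\vee$ for any (possibly infinite) set $\mathcal H$ of infinitary formulas, and $G\to H$; satisfaction by an interpretation (subset of $\sigma$) is classical. The reduct $F^{\mathcal I}$ is $\bot$ if $\mathcal I\not\models F$; otherwise $A^{\mathcal I}=A$, $(\mathcal H^\wedge)^{\mathcal I}=\{G^{\mathcal I}:G\in\mathcal H\}^\wedge$, $(\mathcal H^\vee)^{\mathcal I}=\{G^{\mathcal I}:G\in\mathcal H\}^\vee$, $(G\to H)^{\mathcal I}=G^{\mathcal I}\to H^{\mathcal I}$. $\mathcal I$ is a stable model of $F$ if it is an inclusion-minimal subset of $\sigma$ satisfying $F^{\mathcal I}$. An infinitary program $\Pi$ is a conjunction of infinitary rules $F\to A$ ($A$ an atom). $\Pi|_A$ is the set of $F$ with $F\to A$ a rule of $\Pi$; the completion of $\Pi$ is the conjunction of $A\leftrightarrow(\Pi|_A)^\vee$ over all $A\in\sigma$. Positive and negative nonnegated atoms: $\mathrm{Pnn}(\bot)=\mathrm{Nnn}(\bot)=\emptyset$; $\mathrm{Pnn}(A)=\{A\}$, $\mathrm{Nnn}(A)=\emptyset$ for an atom $A$; $\mathrm{Pnn}(\mathcal H^\wedge)=\mathrm{Pnn}(\mathcal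 H^\vee)=\bigcup_{H\in\mathcal H}\mathrm{Pnn}(H)$ and likewise for $\mathrm{Nnn}$; $\mathrm{Pnn}(G\to H)$ is $\emptyset$ if $H=\bot$ and $\mathrm{Nnn}(G)\cup\mathrm{Pnn}(H)$ otherwise; $\mathrm{Nnn}(G\to H)$ is $\emptyset$ if $H=\bot$ and $\mathrm{Pnn}(G)\cup\mathrm{Nnn}(H)$ otherwise. For $A,B\in\mathcal I$, $B$ is a parent of $A$ relative to $\Pi$ and $\mathcal I$ if there is a rule $F\to A$ of $\Pi$ with $\mathcal I\models F$ and $B\in\mathrm{Pnn}(F)$. $\Pi$ is tight on $\mathcal I$ if there is no infinite sequence $A_0,A_1,\dots$ of elements of $\mathcal I$ with $A_{i+1}$ a parent of $A_i$ relative to $\Pi$ and $\mathcal I$ for every $i$. -}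

module Defs where

open import Level using (0ℓ)
open import Data.Nat using (ℕ; zero; suc)
open import Data.Empty using (⊥)
open import Data.Bool using (Bool; true; false)
open import Data.Product using (Σ; _×_; _,_)
open import Data.Sum using (_⊎_)
open import Relation.Nullary using (Dec; yes; no; ¬_)
open import Relation.Binary.PropositionalEquality using (_≡_)

-- Classical principles (the paper works in classical set theory).

LEM : Set₁
LEM = (P : Set) → Dec P

DC : Set₁
DC = {A : Set} (R : A → A → Set) → (∀ a → Σ A (λ b → R a b)) →
     (a : A) → Σ (ℕ → A) (λ f → f zero ≡ a × (∀ n → R (f n) (f (suc n))))

-- Infinitary formulas over a signature σ (a set of atoms).
-- A (possibly infinite) set 𝓗 of formulas is given as a family indexed by a set K.

data Formula (σ : Set) : Set₁ where
  atom : σ → Formula σ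
  ⊥'   : Formula σ
  ⋀    : (K : Set) → (K → Formula σ) → Formula σ
  ⋁    : (K : Set) → (K → Formula σ) → Formula σ
  _⇒_  : Formula σ → Formula σ → Formula σ

infixr 5 _⇒_

_⇔_ : {σ : Set} → Formula σ → Formula σ → Formula σ
F ⇔ G = ⋀ Bool (λ { true → F ⇒ G ; false → G ⇒ F })

Interp : Set → Set₁
Interp σ = σ → Set

_⊆_ : {σ : Set} → Interp σ → Interp σ → Set
J ⊆ I = ∀ a → J a → I a

_⊨_ : {σ : Set} → Interp σ → Formula σ → Set
I ⊨ atom a  = I a
I ⊨ ⊥'      = ⊥
I ⊨ ⋀ K f   = (k : K) → I ⊨ f k
I ⊨ ⋁ K f   = Σ K (λ k → I ⊨ f k)
I ⊨ (G ⇒ H) = I ⊨ G → I ⊨ H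

reduct : {σ : Set} → LEM → Interp σ → Formula σ → Formula σ
reduct lem I F with lem (I ⊨ F)
... | no _ = ⊥'
reduct lem I (atom a)  | yes _ = atom a
reduct lem I ⊥'        | yes _ = ⊥'
reduct lem I (⋀ K f)   | yes _ = ⋀ K (λ k → reduct lem I (f k))
reduct lem I (⋁ K f)   | yes _ = ⋁ K (λ k → reduct lem I (f k))
reduct lem I (G ⇒ H)   | yes _ = reduct lem I G ⇒ reduct lem I H

StableModel : {σ : Set} → LEM → Formula σ → Interp σ → Set₁
StableModel lem F I =
  (I ⊨ reduct lem I F) ×
  ((J : Interp _) → J ⊆ I → J ⊨ reduct lem I F → I ⊆ J)

record Program (σ : Set) : Set₁ where
  field
    Rule : Set
    body : Rule → Formula σ
    head : Rule → σ
open Program public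

⟦_⟧ : {σ : Set} → Program σ → Formula σ
⟦ Π ⟧ = ⋀ (Rule Π) (λ r → body Π r ⇒ atom (head Π r))

bodiesOf : {σ : Set} → Program σ → σ → Formula σ
bodiesOf Π a = ⋁ (Σ (Rule Π) (λ r → head Π r ≡ a)) (λ { (r , _) → body Π r })

completion : {σ : Set} → Program σ → Formula σ
completion {σ} Π = ⋀ σ (λ a → atom a ⇔ bodiesOf Π a)

Pnn Nnn : {σ : Set} → Formula σ → σ → Set
Pnn (atom a)        b = a ≡ b
Pnn ⊥'              b = ⊥
Pnn (⋀ K f)         b = Σ K (λ k → Pnn (f k) b)
Pnn (⋁ K f)         b = Σ K (λ k → Pnn (f k) b)
Pnn (G ⇒ ⊥')        b = ⊥
Pnn (G ⇒ atom a)    b = Nnn G b ⊎ Pnn (atom a) b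
Pnn (G ⇒ ⋀ K f)     b = Nnn G b ⊎ Pnn (⋀ K f) b
Pnn (G ⇒ ⋁ K f)     b = Nnn G b ⊎ Pnn (⋁ K f) b
Pnn (G ⇒ (H ⇒ H'))  b = Nnn G b ⊎ Pnn (H ⇒ H') b
Nnn (atom a)        b = ⊥
Nnn ⊥'              b = ⊥
Nnn (⋀ K f)         b = Σ K (λ k → Nnn (f k) b)
Nnn (⋁ K f)         b = Σ K (λ k → Nnn (f k) b)
Nnn (G ⇒ ⊥')        b = ⊥
Nnn (G ⇒ atom a)    b = Pnn G b ⊎ Nnn (atom a) b
Nnn (G ⇒ ⋀ K f)     b = Pnn G b ⊎ Nnn (⋀ K f) b
Nnn (G ⇒ ⋁ K f)     b = Pnn G b ⊎ Nnn (⋁ K f) b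
Nnn (G ⇒ (H ⇒ H'))  b = Pnn G b ⊎ Nnn (H ⇒ H') b

Parent : {σ : Set} → Program σ → Interp σ → σ → σ → Set
Parent Π I b a =
  I a × I b × Σ (Rule Π) (λ r → head Π r ≡ a × I ⊨ body Π r × Pnn (body Π r) b)

Tight : {σ : Set} → Program σ → Interp σ → Set
Tight Π I =
  ¬ Σ (ℕ → _) (λ s → (∀ i → I (s i)) × (∀ i → Parent Π I (s (suc i)) (s i)))

-- If I satisfies the completion but some J ⊆ I also satisfies Π^I, every atom of I ∖ J is the
-- head of a rule whose body holds in I but whose reduct fails in J; such a body has a positive
-- nonnegated atom in I ∖ J, which is a parent of the head. Dependent choice turns this into an
-- infinite descending chain of parents, contradicting tightness.
module Submission where

open import Defs
open import Data.Nat using (ℕ; suc)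
open import Data.Empty using (⊥-elim)
open import Data.Bool using (true; false)
open import Data.Product using (Σ; _×_; _,_; proj₁; proj₂)
open import Data.Sum using (inj₂)
open import Relation.Nullary using (yes; no; ¬_)
open import Relation.Binary.PropositionalEquality using (refl)

_∖_ : {σ : Set} → Interp σ → Interp σ → Interp σ
(I ∖ J) b = I b × ¬ J b

Pnn-⇒ʳ : {σ : Set} (G H : Formula σ) {b : σ} → Pnn H b → Pnn (G ⇒ H) b
Pnn-⇒ʳ G (atom a) p = inj₂ p
Pnn-⇒ʳ G ⊥'       ()
Pnn-⇒ʳ G (⋀ K f)  p = inj₂ p
Pnn-⇒ʳ G (⋁ K f)  p = inj₂ p
Pnn-⇒ʳ G (H ⇒ H') p = inj₂ p

module _ (lem : LEM) {σ : Set} (I : Interp σ) where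

  reduct-⊨ : ∀ {J} F → J ⊨ reduct lem I F → I ⊨ F
  reduct-⊨ F h with lem (I ⊨ F)
  ... | yes p = p
  reduct-⊨ F () | no _

  reduct-atom : ∀ {J} a → J ⊨ reduct lem I (atom a) → J a
  reduct-atom a h with lem (I a)
  ... | yes _ = h
  reduct-atom a () | no _

  reduct-⋀ : ∀ {J K} f → J ⊨ reduct lem I (⋀ K f) → ∀ k → J ⊨ reduct lem I (f k)
  reduct-⋀ {K = K} f h k with lem (I ⊨ ⋀ K f)
  ... | yes _ = h k
  reduct-⋀ f () k | no _

  reduct-mp : ∀ {J} G H → J ⊨ reduct lem I (G ⇒ H) → J ⊨ reduct lem I G → J ⊨ reduct lem I H
  reduct-mp G H h g with lem (I ⊨ (G ⇒ H))
  ... | yes _ = h g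
  reduct-mp G H () g | no _

  reduct-satisfied : ∀ {J} F → (∀ b → Pnn F b → I b → J b) → I ⊨ F → J ⊨ reduct lem I F
  reduct-satisfied F h iF with lem (I ⊨ F)
  ... | no ¬iF = ⊥-elim (¬iF iF)
  reduct-satisfied (atom a) h iF       | yes _ = h a refl iF
  reduct-satisfied (⋀ K f)  h iF       | yes _ =
    λ k → reduct-satisfied (f k) (λ b p → h b (k , p)) (iF k)
  reduct-satisfied (⋁ K f)  h (k , iF) | yes _ =
    k , reduct-satisfied (f k) (λ b p → h b (k , p)) iF
  reduct-satisfied (G ⇒ H)  h iF       | yes _ =
    λ jG → reduct-satisfied H (λ b p → h b (Pnn-⇒ʳ G H p)) (iF (reduct-⊨ G jG))

  ⊨⇒⊨-reduct : ∀ F → I ⊨ F → I ⊨ reduct lem I F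
  ⊨⇒⊨-reduct F = reduct-satisfied F (λ _ _ ib → ib)

  reduct-violated : ∀ {J} F → I ⊨ F → ¬ (J ⊨ reduct lem I F) →
                    Σ σ (λ b → Pnn F b × (I ∖ J) b)
  reduct-violated {J} F iF ¬jF with lem (Σ σ (λ b → Pnn F b × (I ∖ J) b))
  ... | yes w = w
  ... | no ¬w = ⊥-elim (¬jF (reduct-satisfied F covered iF))
    where
    covered : ∀ b → Pnn F b → I b → J b
    covered b p ib with lem (J b)
    ... | yes jb = jb
    ... | no ¬jb = ⊥-elim (¬w (b , p , ib , ¬jb))

module _ {σ : Set} (Π : Program σ) (I : Interp σ) (comp : I ⊨ completion Π) where

  completion⇒model : I ⊨ ⟦ Π ⟧
  completion⇒model r ib = comp (head Π r) false ((r , refl) , ib)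

  unsupported-parent : (lem : LEM) {J : Interp σ} → J ⊨ reduct lem I ⟦ Π ⟧ →
                       ∀ a → (I ∖ J) a → Σ σ (λ b → (I ∖ J) b × Parent Π I b a)
  unsupported-parent lem {J} jΠ a (ia , ¬ja) with comp a true ia
  ... | (r , refl) , ib with reduct-violated lem I (body Π r) ib ¬jBody
    where
    ¬jBody : ¬ (J ⊨ reduct lem I (body Π r))
    ¬jBody jb = ¬ja (reduct-atom lem I (head Π r)
      (reduct-mp lem I (body Π r) (atom (head Π r)) (reduct-⋀ lem I _ jΠ r) jb))
  ... | b , p , ib' , ¬jb = b , (ib' , ¬jb) , (ia , ib' , r , refl , ib , p)

  tight⇒minimal : (lem : LEM) → DC → Tight Π I → (J : Interp σ) →
                  J ⊨ reduct lem I ⟦ Π ⟧ → I ⊆ J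
  tight⇒minimal lem dc tight J jΠ a ia with lem (J a)
  ... | yes ja = ja
  ... | no ¬ja = ⊥-elim (tight (atomAt , (λ i → proj₁ (proj₂ (chain i))) , descends))
    where
    Unsupported : Set
    Unsupported = Σ σ (I ∖ J)

    ParentOf : Unsupported → Unsupported → Set
    ParentOf x y = Parent Π I (proj₁ y) (proj₁ x)

    step : (x : Unsupported) → Σ Unsupported (ParentOf x)
    step (x , ux) with unsupported-parent lem jΠ x ux
    ... | y , uy , parent = (y , uy) , parent

    chain : ℕ → Unsupported
    chain = proj₁ (dc ParentOf step (a , ia , ¬ja))

    descends : ∀ i → ParentOf (chain i) (chain (suc i))
    descends = proj₂ (proj₂ (dc ParentOf step (a , ia , ¬ja)))

    atomAt : ℕ → σ
    atomAt i = proj₁ (chain i)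

lemma8 : (lem : LEM) → DC → {σ : Set} (Π : Program σ) (I : Interp σ) →
    Tight Π I → I ⊨ completion Π → StableModel lem ⟦ Π ⟧ I
lemma8 lem dc Π I tight comp =
    ⊨⇒⊨-reduct lem I ⟦ Π ⟧ (completion⇒model Π I comp)
  , λ J _ → tight⇒minimal Π I comp lem dc tight J
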